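{- For any surjection $f:\omega\to\omega$ and any $Z\in(\omega)^\omega$ there is $X\in(\omega)^\omega$ with $X\sqsubseteq Z$ such that $f$ either respects $X$ or completely disregards $X$.
   Context: A partition of $\omega$ is a set of pairwise disjoint nonempty subsets (blocks) of $\omega$ with union $\omega$. $(\omega)^\omega$ is the set of partitions of $\omega$ with infinitely many blocks; $\{\omega\}$ is the one-block partition. For partitions $X,Y$, $X\sqsubseteq Y$ ($X$ coarser than $Y$) means every block of $X$ is a union of blocks of $Y$. For a surjection $f:\omega\to\omega$ and a partition $X$, $f(X)$ is the finest partition of $\omega$ such that whenever $n,m$ lie in the same block of $X$, $f(n),f(m)$ lie in the same block of $f(X)$; and for a partition $W$, $f^{ -1}(W):=\{f^{ -1}(b):b\in W\}$ where $f^{ -1}(b)=\{n:f(n)\in b\}$. The surjection $f$ respects $X$ if $f^{ -1}(f(X))=X$, and completely disregards $X$ if $f^{ -1}(f(X))=\{\omega\}$. -}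

module Defs where

open import Data.Nat using (ℕ)
open import Data.Fin using (Fin)
open import Data.Product using (Σ; ∃; _×_)
open import Relation.Nullary using (¬_)
open import Relation.Binary.PropositionalEquality using (_≡_)
open import Relation.Binary.Structures using (IsEquivalence)

-- A partition of ω, represented by its equivalence relation
-- "n and m lie in the same block".  (Blocks = equivalence classes;
-- these are exactly the pairwise disjoint nonempty sets covering ω.)
record Partition : Set₁ where
  field
    _∼_   : ℕ → ℕ → Set
    isEquivalence : IsEquivalence _∼_
open Partition public

-- X ∈ (ω)^ω : X has infinitely many blocks, i.e. for every k there are
-- k elements lying in pairwise different blocks.
InfBlocks : Partition → Set
InfBlocks X = ∀ k → Σ (Fin k → ℕ) λ a → ∀ i j → _∼_ X (a i) (a j) → i ≡ j

-- X ⊑ Z : X is coarser than Z (every block of X is a union of blocks of Z),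
-- i.e. elements in the same Z-block are in the same X-block.
_⊑_ : Partition → Partition → Set
X ⊑ Z = ∀ n m → _∼_ Z n m → _∼_ X n m

IsSurjection : (ℕ → ℕ) → Set
IsSurjection f = ∀ m → ∃ λ n → f n ≡ m

-- f(X): the finest partition in which f(n), f(m) share a block whenever
-- n, m share an X-block, i.e. the equivalence relation generated by
-- { (f n , f m) : n ∼_X m }.
data ImgRel (f : ℕ → ℕ) (X : Partition) : ℕ → ℕ → Set where
  img   : ∀ {n m} → _∼_ X n m → ImgRel f X (f n) (f m)
  irefl : ∀ {a} → ImgRel f X a a
  isym  : ∀ {a b} → ImgRel f X a b → ImgRel f X b a
  itrans : ∀ {a b c} → ImgRel f X a b → ImgRel f X b c → ImgRel f X a c

image : (ℕ → ℕ) → Partition → Partition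
image f X = record
  { _∼_ = ImgRel f X
  ; isEquivalence = record { refl = irefl ; sym = isym ; trans = itrans } }

-- f⁻¹(W) = { f⁻¹(b) : b ∈ W }  (for surjective f all f⁻¹(b) are nonempty):
-- n, m share a block iff f n, f m share a W-block.
preimage : (ℕ → ℕ) → Partition → Partition
preimage f W = record
  { _∼_ = λ n m → _∼_ W (f n) (f m)
  ; isEquivalence = record
      { refl = IsEquivalence.refl (isEquivalence W)
      ; sym = IsEquivalence.sym (isEquivalence W)
      ; trans = IsEquivalence.trans (isEquivalence W) } }

_≐_ : Partition → Partition → Set
X ≐ Y = ∀ n m → (_∼_ X n m → _∼_ Y n m) × (_∼_ Y n m → _∼_ X n m)

oneBlock : Partition
oneBlock = record
  { _∼_ = λ _ _ → ⊤′
  ; isEquivalence = record { refl = tt′ ; sym = λ _ → tt′ ; trans = λ _ _ → tt′ } }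
  where
  open import Data.Unit using () renaming (⊤ to ⊤′; tt to tt′)

Respects : (ℕ → ℕ) → Partition → Set
Respects f X = preimage f (image f X) ≐ X

CompletelyDisregards : (ℕ → ℕ) → Partition → Set
CompletelyDisregards f X = preimage f (image f X) ≐ oneBlock

-- If f⁻¹(f(Z)) has infinitely many blocks it is the required X: it is
-- coarser than Z, and f respects every partition of the form f⁻¹(W).
-- Otherwise finitely many elements a₀ … a_{j-1} meet every block of f⁻¹(f(Z)).
-- Merging the Z-blocks of 0, a₀, …, a_{j-1} into one block gives X ⊑ Z, still
-- with infinitely many blocks, and in f(X) every f(n) is joined to some f(aᵢ)
-- and hence to f(0); so f(X) has a single block and f completely disregards X.
module Submission where

open import Defs
open import Level using (0ℓ)
open import Axiom.ExcludedMiddle using (ExcludedMiddle)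
open import Data.Nat using (ℕ; zero; suc)
open import Data.Fin using (Fin; punchIn) renaming (zero to fz; suc to fs)
open import Data.Fin.Properties using (punchIn-injective; punchInᵢ≢i; suc-injective) renaming (_≟_ to _≟F_)
open import Data.Vec.Functional using (_∷_)
open import Data.Product using (Σ; _×_; _,_; proj₁; proj₂)
open import Data.Sum using (_⊎_; inj₁; inj₂)
open import Data.Unit using (tt)
open import Data.Empty using (⊥; ⊥-elim)
open import Relation.Nullary using (¬_; yes; no)
open import Relation.Nullary.Negation using (¬∃⟶∀¬)
open import Relation.Binary.PropositionalEquality using (_≡_; _≢_; refl; sym; cong)
open import Relation.Binary.Structures using (IsEquivalence)
open import Function using (_∘_)

Separated : ∀ {k} → Partition → (Fin k → ℕ) → Set
Separated X a = ∀ i j → _∼_ X (a i) (a j) → i ≡ j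

Covers : ∀ {k} → Partition → (Fin k → ℕ) → Set
Covers {k} X a = ∀ n → Σ (Fin k) λ i → _∼_ X n (a i)

FinitelyCovered : Partition → Set
FinitelyCovered X = Σ ℕ λ k → Σ (Fin k → ℕ) (Covers X)

image-mono : ∀ f {X Y} → X ⊑ Y → image f X ⊑ image f Y
image-mono f X⊑Y _ _ (img r)        = img (X⊑Y _ _ r)
image-mono f X⊑Y _ _ irefl          = irefl
image-mono f X⊑Y _ _ (isym r)       = isym (image-mono f X⊑Y _ _ r)
image-mono f X⊑Y _ _ (itrans r r′) = itrans (image-mono f X⊑Y _ _ r) (image-mono f X⊑Y _ _ r′)

preimage-image-⊑ : ∀ f X → preimage f (image f X) ⊑ X
preimage-image-⊑ f X _ _ = img

image-preimage-⊒ : ∀ f W → W ⊑ image f (preimage f W)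
image-preimage-⊒ f W _ _ (img r)        = r
image-preimage-⊒ f W _ _ irefl          = IsEquivalence.refl (isEquivalence W)
image-preimage-⊒ f W _ _ (isym r)       = IsEquivalence.sym (isEquivalence W) (image-preimage-⊒ f W _ _ r)
image-preimage-⊒ f W _ _ (itrans r r′) =
  IsEquivalence.trans (isEquivalence W) (image-preimage-⊒ f W _ _ r) (image-preimage-⊒ f W _ _ r′)

preimage-respected : ∀ f W → Respects f (preimage f W)
preimage-respected f W n m = image-preimage-⊒ f W _ _ , img

disregarded-if-image-connected : ∀ f X c → (∀ n → ImgRel f X (f n) (f c)) →
  CompletelyDisregards f X
disregarded-if-image-connected f X c to-c n m = (λ _ → tt) , (λ _ → itrans (to-c n) (isym (to-c m)))

module _ (Y : Partition) where
  private
    _≈_ = _∼_ Y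
    module Y = IsEquivalence (isEquivalence Y)

  InEither : ℕ → ℕ → ℕ → Set
  InEither p q x = x ≈ p ⊎ x ≈ q

  private
    InEither-resp : ∀ {p q n m} → n ≈ m → InEither p q m → InEither p q n
    InEither-resp n≈m (inj₁ m≈p) = inj₁ (Y.trans n≈m m≈p)
    InEither-resp n≈m (inj₂ m≈q) = inj₂ (Y.trans n≈m m≈q)

  MergeRel : ℕ → ℕ → ℕ → ℕ → Set
  MergeRel p q n m = n ≈ m ⊎ (InEither p q n × InEither p q m)

  merge : ℕ → ℕ → Partition
  merge p q = record
    { _∼_ = MergeRel p q
    ; isEquivalence = record
      { refl  = inj₁ Y.refl
      ; sym   = λ { (inj₁ r) → inj₁ (Y.sym r) ; (inj₂ (s , t)) → inj₂ (t , s) }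
      ; trans = trans } }
    where
    trans : ∀ {n m r} → MergeRel p q n m → MergeRel p q m r → MergeRel p q n r
    trans (inj₁ n≈m)     (inj₁ m≈r)     = inj₁ (Y.trans n≈m m≈r)
    trans (inj₁ n≈m)     (inj₂ (s , t)) = inj₂ (InEither-resp n≈m s , t)
    trans (inj₂ (s , t)) (inj₁ m≈r)     = inj₂ (s , InEither-resp (Y.sym m≈r) t)
    trans (inj₂ (s , _)) (inj₂ (_ , t)) = inj₂ (s , t)

  merge-⊑ : ∀ p q → merge p q ⊑ Y
  merge-⊑ p q _ _ = inj₁

  merge-joins : ∀ p q → _∼_ (merge p q) p q
  merge-joins p q = inj₂ (inj₁ Y.refl , inj₂ Y.refl)

  InEither-pigeonhole : ∀ {k p q} {b : Fin k → ℕ} → Separated Y b →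
    ∀ {x y z} → x ≢ y → x ≢ z → y ≢ z →
    InEither p q (b x) → InEither p q (b y) → InEither p q (b z) → ⊥
  InEither-pigeonhole {p = p} {q} {b} sep {x} {y} {z} x≢y x≢z y≢z = go
    where
    same : ∀ {u v c} → b u ≈ c → b v ≈ c → u ≡ v
    same u≈c v≈c = sep _ _ (Y.trans u≈c (Y.sym v≈c))
    go : InEither p q (b x) → InEither p q (b y) → InEither p q (b z) → ⊥
    go (inj₁ s) (inj₁ t) _        = x≢y (same s t)
    go (inj₂ s) (inj₂ t) _        = x≢y (same s t)
    go (inj₁ s) (inj₂ _) (inj₁ u) = x≢z (same s u)
    go (inj₁ _) (inj₂ t) (inj₂ u) = y≢z (same t u)
    go (inj₂ _) (inj₁ t) (inj₁ u) = y≢z (same t u)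
    go (inj₂ s) (inj₁ _) (inj₂ u) = x≢z (same s u)

  -- Among k + 1 separated elements at most two meet the merged block; dropping
  -- one that does leaves k elements that stay separated after merging.
  merge-infinite : ExcludedMiddle 0ℓ → ∀ p q → InfBlocks Y → InfBlocks (merge p q)
  merge-infinite em p q inf k with inf (suc k)
  ... | b , sep with em {Σ (Fin (suc k)) λ i → InEither p q (b i)}
  ... | no none = b ∘ fs , sep′
    where
    sep′ : Separated (merge p q) (b ∘ fs)
    sep′ i j (inj₁ r)       = suc-injective (sep _ _ r)
    sep′ i j (inj₂ (s , _)) = ⊥-elim (none (fs i , s))
  ... | yes (i₀ , s₀) = b ∘ punchIn i₀ , sep′
    where
    sep′ : Separated (merge p q) (b ∘ punchIn i₀)
    sep′ i j (inj₁ r) = punchIn-injective i₀ i j (sep _ _ r)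
    sep′ i j (inj₂ (s , t)) with i ≟F j
    ... | yes i≡j = i≡j
    ... | no i≢j  = ⊥-elim (InEither-pigeonhole sep
      (punchInᵢ≢i i₀ i ∘ sym) (punchInᵢ≢i i₀ j ∘ sym) (i≢j ∘ punchIn-injective i₀ i j) s₀ s t)

mergeInto : ∀ {j} → ℕ → (Fin j → ℕ) → Partition → Partition
mergeInto {zero}  c a Y = Y
mergeInto {suc j} c a Y = mergeInto c (a ∘ fs) (merge Y c (a fz))

mergeInto-⊑ : ∀ {j} c (a : Fin j → ℕ) Y → mergeInto c a Y ⊑ Y
mergeInto-⊑ {zero}  c a Y n m r = r
mergeInto-⊑ {suc j} c a Y n m r = mergeInto-⊑ c (a ∘ fs) _ n m (merge-⊑ Y c (a fz) n m r)

mergeInto-joins : ∀ {j} c (a : Fin j → ℕ) Y i → _∼_ (mergeInto c a Y) (a i) c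
mergeInto-joins {suc j} c a Y fz     = mergeInto-⊑ c (a ∘ fs) _ _ _
  (IsEquivalence.sym (isEquivalence (merge Y c (a fz))) (merge-joins Y c (a fz)))
mergeInto-joins {suc j} c a Y (fs i) = mergeInto-joins c (a ∘ fs) _ i

mergeInto-infinite : ExcludedMiddle 0ℓ → ∀ {j} c (a : Fin j → ℕ) Y → InfBlocks Y →
  InfBlocks (mergeInto c a Y)
mergeInto-infinite em {zero}  c a Y inf = inf
mergeInto-infinite em {suc j} c a Y inf =
  mergeInto-infinite em c (a ∘ fs) _ (merge-infinite Y em c (a fz) inf)

module _ (em : ExcludedMiddle 0ℓ) (X : Partition) where

  separated-or-finitelyCovered : ∀ k → Σ (Fin k → ℕ) (Separated X) ⊎ FinitelyCovered X
  separated-or-finitelyCovered zero = inj₁ ((λ ()) , λ ())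
  separated-or-finitelyCovered (suc k) with separated-or-finitelyCovered k
  ... | inj₂ cov = inj₂ cov
  ... | inj₁ (a , sep) with em {Σ ℕ λ n → ∀ i → ¬ _∼_ X n (a i)}
  ... | yes (n , apart) = inj₁ (n ∷ a , sep′)
    where
    sep′ : Separated X (n ∷ a)
    sep′ fz     fz     _ = refl
    sep′ fz     (fs j) r = ⊥-elim (apart j r)
    sep′ (fs i) fz     r = ⊥-elim (apart i (IsEquivalence.sym (isEquivalence X) r))
    sep′ (fs i) (fs j) r = cong fs (sep i j r)
  ... | no none = inj₂ (k , a , cover)
    where
    cover : Covers X a
    cover n with em {Σ (Fin k) λ i → _∼_ X n (a i)}
    ... | yes hit = hit
    ... | no miss = ⊥-elim (none (n , ¬∃⟶∀¬ miss))

  infinite-or-finitelyCovered : InfBlocks X ⊎ FinitelyCovered X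
  infinite-or-finitelyCovered with em {FinitelyCovered X}
  ... | yes cov = inj₂ cov
  ... | no ¬cov = inj₁ λ k → separatedOf (separated-or-finitelyCovered k)
    where
    separatedOf : ∀ {k} → Σ (Fin k → ℕ) (Separated X) ⊎ FinitelyCovered X →
      Σ (Fin k → ℕ) (Separated X)
    separatedOf (inj₁ sep) = sep
    separatedOf (inj₂ cov) = ⊥-elim (¬cov cov)

mergeInto-disregarded : ∀ f Z {j} (a : Fin j → ℕ) → Covers (preimage f (image f Z)) a →
  ∀ c → CompletelyDisregards f (mergeInto c a Z)
mergeInto-disregarded f Z a cover c = disregarded-if-image-connected f (mergeInto c a Z) c λ n →
  itrans (image-mono f (mergeInto-⊑ c a Z) _ _ (proj₂ (cover n)))
         (img (mergeInto-joins c a Z (proj₁ (cover n))))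

lemma2p2 : ExcludedMiddle 0ℓ → (f : ℕ → ℕ) → IsSurjection f →
    (Z : Partition) → InfBlocks Z →
    Σ Partition λ X → InfBlocks X × X ⊑ Z × (Respects f X ⊎ CompletelyDisregards f X)
lemma2p2 em f _ Z infZ with infinite-or-finitelyCovered em (preimage f (image f Z))
... | inj₁ infP =
  preimage f (image f Z) , infP , preimage-image-⊑ f Z , inj₁ (preimage-respected f (image f Z))
... | inj₂ (_ , a , cover) =
  mergeInto 0 a Z , mergeInto-infinite em 0 a Z infZ , mergeInto-⊑ 0 a Z ,
  inj₂ (mergeInto-disregarded f Z a cover 0)
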